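{- Let $M$ be a term. (1) $M$ is $\mathsf v$-potentially valuable if and only if $M$ is $\beta_v$-potentially valuable. (2) $M$ is $\mathsf v$-solvable if and only if $M$ is $\beta_v$-solvable.
   Context: Terms and values of the call-by-value $\lambda$-calculus are defined by mutual induction from a countably infinite set of variables: values $V ::= x \mid \lambda x.M$ and terms $M,N,L ::= V \mid MN$, up to $\alpha$-conversion, application associating to the left; $\lambda x_1\dots x_k.N$ abbreviates $\lambda x_1.(\dots(\lambda x_k.N))$; $\mathrm{fv}(M)$ is the set of free variables; $N\{V_1/x_1,\dots,V_k/x_k\}$ is capture-avoiding simultaneous substitution of values. Root rules: $(\lambda x.M)V \mapsto_{\beta_v} M\{V/x\}$ ($V$ a value); $(\lambda x.M)NL \mapsto_{\sigma_1} (\lambda x.ML)N$ if $x\notin\mathrm{fv}(L)$; $V((\lambda x.L)N) \mapsto_{\sigma_3} (\lambda x.VL)N$ ($V$ a value, $x\notin\mathrm{fv}(V)$); $\mapsto_{\mathsf v}=\mapsto_{\beta_v}\cup\mapsto_{\sigma_1}\cup\mapsto_{\sigma_3}$. $\to_{\beta_v}$ and $\to_{\mathsf v}$ are the closures of $\mapsto_{\beta_v}$, $\mapsto_{\mathsf v}$ under one-hole contexts $C ::= [\cdot]\mid \lambda x.C\mid CM\mid MC$; $^*$ denotes reflexive-transitive closure. Let $I=\lambda x.x$. For $r\in\{\beta_v,\mathsf v\}$ and a term $N$ with $\mathrm{fv}(N)=\{x_1,\dots,x_k\}$ (pairwise distinct, $k\ge0$): $N$ is $r$-potentially valuable if there are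 values $V_1,\dots,V_k,V$ with $N\{V_1/x_1,\dots,V_k/x_k\}\to_r^* V$; $N$ is $r$-solvable if there are $n\ge0$ and terms $M_1,\dots,M_n$ with $(\lambda x_1\dots x_k.N)M_1\cdots M_n\to_r^* I$. -}

module Defs where

open import Data.Nat using (ℕ; zero; suc)
open import Data.Fin using (Fin; zero; suc)
open import Data.List using (List; []; _∷_)
open import Data.Product using (Σ; ∃; _×_; _,_)
open import Data.Empty using (⊥)
open import Data.Unit using (⊤)
open import Relation.Binary.Construct.Closure.ReflexiveTransitive using (Star)

-- Terms of the λ-calculus, de Bruijn style, scoped by the number n of
-- variables available (α-conversion is built in).
data Term (n : ℕ) : Set where
  var : Fin n → Term n
  lam : Term (suc n) → Term n
  app : Term n → Term n → Term n

data IsValue {n : ℕ} : Term n → Set where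
  var-val : (x : Fin n) → IsValue (var x)
  lam-val : (M : Term (suc n)) → IsValue (lam M)

ext : ∀ {n m} → (Fin n → Fin m) → Fin (suc n) → Fin (suc m)
ext ρ zero    = zero
ext ρ (suc x) = suc (ρ x)

rename : ∀ {n m} → (Fin n → Fin m) → Term n → Term m
rename ρ (var x)   = var (ρ x)
rename ρ (lam M)   = lam (rename (ext ρ) M)
rename ρ (app M N) = app (rename ρ M) (rename ρ N)

weaken : ∀ {n} → Term n → Term (suc n)
weaken = rename suc

exts : ∀ {n m} → (Fin n → Term m) → Fin (suc n) → Term (suc m)
exts σ zero    = var zero
exts σ (suc x) = weaken (σ x)

subst : ∀ {n m} → (Fin n → Term m) → Term n → Term m
subst σ (var x)   = σ x
subst σ (lam M)   = lam (subst (exts σ) M)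
subst σ (app M N) = app (subst σ M) (subst σ N)

-- M{V/x} where x is the variable bound by the outermost removed binder.
subst₁ : ∀ {n} → Term (suc n) → Term n → Term n
subst₁ {n} M V = subst σ M
  where
  σ : Fin (suc n) → Term n
  σ zero    = V
  σ (suc x) = var x

-- Root rules.  The side conditions x ∉ fv(L), x ∉ fv(V) are enforced by
-- weakening L (resp. V) under the new binder.
data _↦βv_ {n : ℕ} : Term n → Term n → Set where
  βv : (M : Term (suc n)) (V : Term n) → IsValue V →
       app (lam M) V ↦βv subst₁ M V

data _↦v_ {n : ℕ} : Term n → Term n → Set where
  βv : (M : Term (suc n)) (V : Term n) → IsValue V →
       app (lam M) V ↦v subst₁ M V
  σ₁ : (M : Term (suc n)) (N L : Term n) →
       app (app (lam M) N) L ↦v app (lam (app M (weaken L))) N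
  σ₃ : (V : Term n) (L : Term (suc n)) (N : Term n) → IsValue V →
       app V (app (lam L) N) ↦v app (lam (app (weaken V) L)) N

data Ctx (R : ∀ {n} → Term n → Term n → Set) {n : ℕ} : Term n → Term n → Set where
  root : ∀ {M N} → R M N → Ctx R M N
  lamC : ∀ {M N : Term (suc n)} → Ctx R M N → Ctx R (lam M) (lam N)
  appL : ∀ {M M' : Term n} (N : Term n) → Ctx R M M' → Ctx R (app M N) (app M' N)
  appR : ∀ (M : Term n) {N N' : Term n} → Ctx R N N' → Ctx R (app M N) (app M N')

_→βv_ : ∀ {n} → Term n → Term n → Set
_→βv_ = Ctx _↦βv_

_→v_ : ∀ {n} → Term n → Term n → Set
_→v_ = Ctx _↦v_

_→*_ : ∀ {n} (R : ∀ {m} → Term m → Term m → Set) → Term n → Term n → Set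
_→*_ R = Star R

data Red : Set where
  βv-red v-red : Red

Step : Red → ∀ {n} → Term n → Term n → Set
Step βv-red = _→βv_
Step v-red  = _→v_

data Occurs {n : ℕ} (x : Fin n) : Term n → Set where
  here  : Occurs x (var x)
  under : ∀ {M} → Occurs (suc x) M → Occurs x (lam M)
  left  : ∀ {M N} → Occurs x M → Occurs x (app M N)
  right : ∀ {M N} → Occurs x N → Occurs x (app M N)

ExactScope : ∀ {n} → Term n → Set
ExactScope {n} M = (x : Fin n) → Occurs x M

I : ∀ {n} → Term n
I = lam (var zero)

close : ∀ n → Term n → Term 0
close zero    N = N
close (suc n) N = close n (lam N)

applyAll : ∀ {n} → Term n → List (Term n) → Term n
applyAll M []       = M
applyAll M (N ∷ Ns) = applyAll (app M N) Ns

closedInto : ∀ {m} → Term 0 → Term m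
closedInto = rename (λ ())

-- r-potentially valuable: some substitution of values for all free
-- variables reduces to a value.  Values may be open (any scope m).
PotValuable : Red → ∀ {n} → Term n → Set
PotValuable r {n} N =
  Σ ℕ λ m → Σ (Fin n → Term m) λ σ → ((x : Fin n) → IsValue (σ x)) ×
    Σ (Term m) λ V → IsValue V × Star (Step r) (subst σ N) V

-- r-solvable: (λx₁…xₖ.N) M₁ ⋯ Mₙ →* I for some (possibly open) terms Mᵢ.
Solvable : Red → ∀ {n} → Term n → Set
Solvable r {n} N =
  Σ ℕ λ m → Σ (List (Term m)) λ Ms →
    Star (Step r) (applyAll (closedInto (close n N)) Ms) I

-- A v-reduction differs from a βv-reduction only by the σ-rules, which permute
-- redexes without changing what call-by-value evaluation computes.  Precisely:
-- parallel v-reduction ⇉ reflects big-step evaluation under value substitutions,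
-- i.e. if M ⇉ M' and M' evaluates to W' then M evaluates to some W ⇉ W'.
-- Iterating along M →v* V, with V a value, gives M ⇓ W, hence M →βv* W with W a
-- value.  When V = I, W = λB with B ⇉* x, and evaluating the open body B
-- reflects back to B ⇓ x, so M →βv* I.  The converse directions hold because
-- every βv-step is a v-step.
module Submission where

open import Defs
open import Data.Nat using (ℕ; zero; suc)
open import Data.Fin using (Fin; zero; suc)
open import Data.Product using (∃; _×_; _,_)
open import Function.Bundles using (_⇔_; mk⇔)
open import Relation.Binary.PropositionalEquality as ≡ using (_≡_; refl; sym; trans; cong; cong₂)
open import Relation.Binary.Construct.Closure.ReflexiveTransitive using (Star; ε; _◅_; _◅◅_; gmap; map)

Sub : ℕ → ℕ → Set
Sub n m = Fin n → Term m

infixr 5 _∷ₛ_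

_∷ₛ_ : ∀ {n m} → Term m → Sub n m → Sub (suc n) m
(U ∷ₛ σ) zero    = U
(U ∷ₛ σ) (suc x) = σ x

ext-cong : ∀ {n m} {ρ ρ' : Fin n → Fin m} → (∀ x → ρ x ≡ ρ' x) → ∀ x → ext ρ x ≡ ext ρ' x
ext-cong h zero    = refl
ext-cong h (suc x) = cong suc (h x)

rename-cong : ∀ {n m} {ρ ρ' : Fin n → Fin m} → (∀ x → ρ x ≡ ρ' x) → ∀ M → rename ρ M ≡ rename ρ' M
rename-cong h (var x)   = cong var (h x)
rename-cong h (lam M)   = cong lam (rename-cong (ext-cong h) M)
rename-cong h (app M N) = cong₂ app (rename-cong h M) (rename-cong h N)

exts-cong : ∀ {n m} {σ σ' : Sub n m} → (∀ x → σ x ≡ σ' x) → ∀ x → exts σ x ≡ exts σ' x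
exts-cong h zero    = refl
exts-cong h (suc x) = cong weaken (h x)

subst-cong : ∀ {n m} {σ σ' : Sub n m} → (∀ x → σ x ≡ σ' x) → ∀ M → subst σ M ≡ subst σ' M
subst-cong h (var x)   = h x
subst-cong h (lam M)   = cong lam (subst-cong (exts-cong h) M)
subst-cong h (app M N) = cong₂ app (subst-cong h M) (subst-cong h N)

rename-∘ : ∀ {n m k} (ρ : Fin m → Fin k) (ρ' : Fin n → Fin m) M →
           rename ρ (rename ρ' M) ≡ rename (λ x → ρ (ρ' x)) M
rename-∘ ρ ρ' (var x)   = refl
rename-∘ ρ ρ' (lam M)   =
  cong lam (trans (rename-∘ (ext ρ) (ext ρ') M) (rename-cong (λ { zero → refl ; (suc x) → refl }) M))
rename-∘ ρ ρ' (app M N) = cong₂ app (rename-∘ ρ ρ' M) (rename-∘ ρ ρ' N)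

subst-rename : ∀ {n m k} (τ : Sub m k) (ρ : Fin n → Fin m) M →
               subst τ (rename ρ M) ≡ subst (λ x → τ (ρ x)) M
subst-rename τ ρ (var x)   = refl
subst-rename τ ρ (lam M)   =
  cong lam (trans (subst-rename (exts τ) (ext ρ) M) (subst-cong (λ { zero → refl ; (suc x) → refl }) M))
subst-rename τ ρ (app M N) = cong₂ app (subst-rename τ ρ M) (subst-rename τ ρ N)

rename-weaken : ∀ {n m} (ρ : Fin n → Fin m) L → rename (ext ρ) (weaken L) ≡ weaken (rename ρ L)
rename-weaken ρ L = trans (rename-∘ (ext ρ) suc L) (sym (rename-∘ suc ρ L))

rename-subst : ∀ {n m k} (ρ : Fin m → Fin k) (τ : Sub n m) M →
               rename ρ (subst τ M) ≡ subst (λ x → rename ρ (τ x)) M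
rename-subst ρ τ (var x)   = refl
rename-subst ρ τ (lam M)   = cong lam (trans (rename-subst (ext ρ) (exts τ) M) (subst-cong ext-exts M))
  where
  ext-exts : ∀ x → rename (ext ρ) (exts τ x) ≡ exts (λ y → rename ρ (τ y)) x
  ext-exts zero    = refl
  ext-exts (suc x) = rename-weaken ρ (τ x)
rename-subst ρ τ (app M N) = cong₂ app (rename-subst ρ τ M) (rename-subst ρ τ N)

subst-weaken : ∀ {n m} (σ : Sub n m) L → subst (exts σ) (weaken L) ≡ weaken (subst σ L)
subst-weaken σ L = trans (subst-rename (exts σ) suc L) (sym (rename-subst suc σ L))

subst-∘ : ∀ {n m k} (τ : Sub m k) (τ' : Sub n m) M →
          subst τ (subst τ' M) ≡ subst (λ x → subst τ (τ' x)) M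
subst-∘ τ τ' (var x)   = refl
subst-∘ τ τ' (lam M)   = cong lam (trans (subst-∘ (exts τ) (exts τ') M) (subst-cong exts-exts M))
  where
  exts-exts : ∀ x → subst (exts τ) (exts τ' x) ≡ exts (λ y → subst τ (τ' y)) x
  exts-exts zero    = refl
  exts-exts (suc x) = subst-weaken τ (τ' x)
subst-∘ τ τ' (app M N) = cong₂ app (subst-∘ τ τ' M) (subst-∘ τ τ' N)

subst-id : ∀ {n} (M : Term n) → subst var M ≡ M
subst-id (var x)   = refl
subst-id (lam M)   = cong lam (trans (subst-cong (λ { zero → refl ; (suc x) → refl }) M) (subst-id M))
subst-id (app M N) = cong₂ app (subst-id M) (subst-id N)

subst₁-∷ₛ : ∀ {n} (M : Term (suc n)) U → subst₁ M U ≡ subst (U ∷ₛ var) M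
subst₁-∷ₛ M U = subst-cong (λ { zero → refl ; (suc x) → refl }) M

subst₁-exts : ∀ {n m} (σ : Sub n m) M U → subst₁ (subst (exts σ) M) U ≡ subst (U ∷ₛ σ) M
subst₁-exts σ M U = begin
  subst₁ (subst (exts σ) M) U                         ≡⟨ subst₁-∷ₛ (subst (exts σ) M) U ⟩
  subst (U ∷ₛ var) (subst (exts σ) M)                 ≡⟨ subst-∘ (U ∷ₛ var) (exts σ) M ⟩
  subst (λ x → subst (U ∷ₛ var) (exts σ x)) M         ≡⟨ subst-cong drop-weaken M ⟩
  subst (U ∷ₛ σ) M                                    ∎
  where
  open ≡.≡-Reasoning
  drop-weaken : ∀ x → subst (U ∷ₛ var) (exts σ x) ≡ (U ∷ₛ σ) x
  drop-weaken zero    = refl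
  drop-weaken (suc x) = trans (subst-rename (U ∷ₛ var) suc (σ x)) (subst-id (σ x))

subst-subst₁ : ∀ {n m} (σ : Sub n m) M V → subst σ (subst₁ M V) ≡ subst (subst σ V ∷ₛ σ) M
subst-subst₁ σ M V = begin
  subst σ (subst₁ M V)                      ≡⟨ cong (subst σ) (subst₁-∷ₛ M V) ⟩
  subst σ (subst (V ∷ₛ var) M)              ≡⟨ subst-∘ σ (V ∷ₛ var) M ⟩
  subst (λ x → subst σ ((V ∷ₛ var) x)) M    ≡⟨ subst-cong (λ { zero → refl ; (suc x) → refl }) M ⟩
  subst (subst σ V ∷ₛ σ) M                  ∎
  where open ≡.≡-Reasoning

subst₁-subst : ∀ {n m} (σ : Sub n m) M V → subst₁ (subst (exts σ) M) (subst σ V) ≡ subst σ (subst₁ M V)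
subst₁-subst σ M V = trans (subst₁-exts σ M (subst σ V)) (sym (subst-subst₁ σ M V))

subst₁-weaken : ∀ {n m} (σ : Sub n m) L U → subst₁ (subst (exts σ) (weaken L)) U ≡ subst σ L
subst₁-weaken σ L U = trans (subst₁-exts σ (weaken L) U) (subst-rename (U ∷ₛ σ) suc L)

rename-subst₁ : ∀ {n m} (ρ : Fin n → Fin m) M V →
                rename ρ (subst₁ M V) ≡ subst₁ (rename (ext ρ) M) (rename ρ V)
rename-subst₁ ρ M V = begin
  rename ρ (subst₁ M V)                               ≡⟨ cong (rename ρ) (subst₁-∷ₛ M V) ⟩
  rename ρ (subst (V ∷ₛ var) M)                       ≡⟨ rename-subst ρ (V ∷ₛ var) M ⟩
  subst (λ x → rename ρ ((V ∷ₛ var) x)) M             ≡⟨ subst-cong (λ { zero → refl ; (suc x) → refl }) M ⟩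
  subst (λ x → (rename ρ V ∷ₛ var) (ext ρ x)) M       ≡⟨ sym (subst-rename (rename ρ V ∷ₛ var) (ext ρ) M) ⟩
  subst (rename ρ V ∷ₛ var) (rename (ext ρ) M)        ≡⟨ sym (subst₁-∷ₛ (rename (ext ρ) M) (rename ρ V)) ⟩
  subst₁ (rename (ext ρ) M) (rename ρ V)              ∎
  where open ≡.≡-Reasoning

IsValueSub : ∀ {n m} → Sub n m → Set
IsValueSub σ = ∀ x → IsValue (σ x)

IsValue-rename : ∀ {n m} (ρ : Fin n → Fin m) {V} → IsValue V → IsValue (rename ρ V)
IsValue-rename ρ (var-val x) = var-val (ρ x)
IsValue-rename ρ (lam-val M) = lam-val _

IsValue-subst : ∀ {n m} {σ : Sub n m} → IsValueSub σ → ∀ {V} → IsValue V → IsValue (subst σ V)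
IsValue-subst vσ (var-val x) = vσ x
IsValue-subst vσ (lam-val M) = lam-val _

IsValueSub-exts : ∀ {n m} {σ : Sub n m} → IsValueSub σ → IsValueSub (exts σ)
IsValueSub-exts vσ zero    = var-val zero
IsValueSub-exts vσ (suc x) = IsValue-rename suc (vσ x)

IsValueSub-∷ₛ : ∀ {n m} {σ : Sub n m} {U} → IsValue U → IsValueSub σ → IsValueSub (U ∷ₛ σ)
IsValueSub-∷ₛ u vσ zero    = u
IsValueSub-∷ₛ u vσ (suc x) = vσ x

Ctx-map : ∀ {R R' : ∀ {n} → Term n → Term n → Set} → (∀ {n} {M N : Term n} → R M N → R' M N) →
          ∀ {n} {M N : Term n} → Ctx R M N → Ctx R' M N
Ctx-map f (root r)   = root (f r)
Ctx-map f (lamC s)   = lamC (Ctx-map f s)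
Ctx-map f (appL N s) = appL N (Ctx-map f s)
Ctx-map f (appR M s) = appR M (Ctx-map f s)

↦βv⇒↦v : ∀ {n} {M N : Term n} → M ↦βv N → M ↦v N
↦βv⇒↦v (βv M V v) = βv M V v

→βv*⇒→v* : ∀ {n} {M N : Term n} → Star _→βv_ M N → Star _→v_ M N
→βv*⇒→v* = map (Ctx-map ↦βv⇒↦v)

infix 4 _⇓_

data _⇓_ {n : ℕ} : Term n → Term n → Set where
  ⇓-val : ∀ {V} → IsValue V → V ⇓ V
  ⇓-app : ∀ {P Q B U W} → P ⇓ lam B → Q ⇓ U → subst₁ B U ⇓ W → app P Q ⇓ W

⇓-IsValue : ∀ {n} {T W : Term n} → T ⇓ W → IsValue W
⇓-IsValue (⇓-val v)     = v
⇓-IsValue (⇓-app _ _ D) = ⇓-IsValue D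

IsValue-⇓ : ∀ {n} {V W : Term n} → IsValue V → V ⇓ W → W ≡ V
IsValue-⇓ v  (⇓-val _)     = refl
IsValue-⇓ () (⇓-app _ _ _)

⇓⇒→βv* : ∀ {n} {T W : Term n} → T ⇓ W → Star _→βv_ T W
⇓⇒→βv* (⇓-val _) = ε
⇓⇒→βv* (⇓-app {P} {Q} {B} {U} D₁ D₂ D₃) =
  gmap (λ P' → app P' Q) (appL Q) (⇓⇒→βv* D₁) ◅◅
  gmap (app (lam B)) (appR (lam B)) (⇓⇒→βv* D₂) ◅◅
  root (βv B U (⇓-IsValue D₂)) ◅ ⇓⇒→βv* D₃

infix 4 _⇉_

data _⇉_ {n : ℕ} : Term n → Term n → Set where
  pvar : ∀ x → var x ⇉ var x
  plam : ∀ {M M'} → M ⇉ M' → lam M ⇉ lam M'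
  papp : ∀ {M M' N N'} → M ⇉ M' → N ⇉ N' → app M N ⇉ app M' N'
  pβ   : ∀ {M M' V V'} → M ⇉ M' → V ⇉ V' → IsValue V → app (lam M) V ⇉ subst₁ M' V'
  pσ₁  : ∀ {M M' N N' L L'} → M ⇉ M' → N ⇉ N' → L ⇉ L' →
         app (app (lam M) N) L ⇉ app (lam (app M' (weaken L'))) N'
  pσ₃  : ∀ {V V' L L' N N'} → V ⇉ V' → IsValue V → L ⇉ L' → N ⇉ N' →
         app V (app (lam L) N) ⇉ app (lam (app (weaken V') L')) N'

⇉-refl : ∀ {n} (M : Term n) → M ⇉ M
⇉-refl (var x)   = pvar x
⇉-refl (lam M)   = plam (⇉-refl M)
⇉-refl (app M N) = papp (⇉-refl M) (⇉-refl N)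

→v⇒⇉ : ∀ {n} {M N : Term n} → M →v N → M ⇉ N
→v⇒⇉ (root (βv M V v))   = pβ (⇉-refl M) (⇉-refl V) v
→v⇒⇉ (root (σ₁ M N L))   = pσ₁ (⇉-refl M) (⇉-refl N) (⇉-refl L)
→v⇒⇉ (root (σ₃ V L N v)) = pσ₃ (⇉-refl V) v (⇉-refl L) (⇉-refl N)
→v⇒⇉ (lamC s)            = plam (→v⇒⇉ s)
→v⇒⇉ (appL N s)          = papp (→v⇒⇉ s) (⇉-refl N)
→v⇒⇉ (appR M s)          = papp (⇉-refl M) (→v⇒⇉ s)

IsValue-⇉ : ∀ {n} {V V' : Term n} → IsValue V → V ⇉ V' → IsValue V'
IsValue-⇉ (var-val x) (pvar .x) = var-val x
IsValue-⇉ (lam-val M) (plam _)  = lam-val _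

IsValue-⇉-lam : ∀ {n} {W : Term n} {B'} → IsValue W → W ⇉ lam B' → ∃ λ B → W ≡ lam B × B ⇉ B'
IsValue-⇉-lam (lam-val B) (plam b) = B , refl , b

⇉*-var : ∀ {n} {x : Fin n} {T} → Star _⇉_ (var x) T → T ≡ var x
⇉*-var ε            = refl
⇉*-var (pvar _ ◅ s) = ⇉*-var s

⇉*-lam : ∀ {n} {B : Term (suc n)} {T} → Star _⇉_ (lam B) T → ∃ λ C → T ≡ lam C × Star _⇉_ B C
⇉*-lam ε = _ , refl , ε
⇉*-lam (plam b ◅ s) with ⇉*-lam s
... | C , refl , s' = C , refl , b ◅ s'

⇉-rename : ∀ {n m} (ρ : Fin n → Fin m) {M M'} → M ⇉ M' → rename ρ M ⇉ rename ρ M'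
⇉-rename ρ (pvar x)   = pvar (ρ x)
⇉-rename ρ (plam h)   = plam (⇉-rename (ext ρ) h)
⇉-rename ρ (papp h k) = papp (⇉-rename ρ h) (⇉-rename ρ k)
⇉-rename ρ (pβ {M' = M'} {V' = V'} h k v) rewrite rename-subst₁ ρ M' V' =
  pβ (⇉-rename (ext ρ) h) (⇉-rename ρ k) (IsValue-rename ρ v)
⇉-rename ρ (pσ₁ {L' = L'} h k l) rewrite rename-weaken ρ L' =
  pσ₁ (⇉-rename (ext ρ) h) (⇉-rename ρ k) (⇉-rename ρ l)
⇉-rename ρ (pσ₃ {V' = V'} h v l k) rewrite rename-weaken ρ V' =
  pσ₃ (⇉-rename ρ h) (IsValue-rename ρ v) (⇉-rename (ext ρ) l) (⇉-rename ρ k)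

_⇉ₛ_ : ∀ {n m} → Sub n m → Sub n m → Set
σ ⇉ₛ σ' = ∀ x → σ x ⇉ σ' x

⇉ₛ-exts : ∀ {n m} {σ σ' : Sub n m} → σ ⇉ₛ σ' → exts σ ⇉ₛ exts σ'
⇉ₛ-exts h zero    = pvar zero
⇉ₛ-exts h (suc x) = ⇉-rename suc (h x)

⇉ₛ-∷ₛ : ∀ {n m} {σ σ' : Sub n m} {U U'} → U ⇉ U' → σ ⇉ₛ σ' → (U ∷ₛ σ) ⇉ₛ (U' ∷ₛ σ')
⇉ₛ-∷ₛ u h zero    = u
⇉ₛ-∷ₛ u h (suc x) = h x

⇉-subst : ∀ {n m} {σ σ' : Sub n m} → σ ⇉ₛ σ' → IsValueSub σ → ∀ {M M'} → M ⇉ M' → subst σ M ⇉ subst σ' M'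
⇉-subst hσ vσ (pvar x)   = hσ x
⇉-subst hσ vσ (plam h)   = plam (⇉-subst (⇉ₛ-exts hσ) (IsValueSub-exts vσ) h)
⇉-subst hσ vσ (papp h k) = papp (⇉-subst hσ vσ h) (⇉-subst hσ vσ k)
⇉-subst {σ' = σ'} hσ vσ (pβ {M' = M'} {V' = V'} h k v) rewrite sym (subst₁-subst σ' M' V') =
  pβ (⇉-subst (⇉ₛ-exts hσ) (IsValueSub-exts vσ) h) (⇉-subst hσ vσ k) (IsValue-subst vσ v)
⇉-subst {σ' = σ'} hσ vσ (pσ₁ {L' = L'} h k l) rewrite subst-weaken σ' L' =
  pσ₁ (⇉-subst (⇉ₛ-exts hσ) (IsValueSub-exts vσ) h) (⇉-subst hσ vσ k) (⇉-subst hσ vσ l)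
⇉-subst {σ' = σ'} hσ vσ (pσ₃ {V' = V'} h v l k) rewrite subst-weaken σ' V' =
  pσ₃ (⇉-subst hσ vσ h) (IsValue-subst vσ v) (⇉-subst (⇉ₛ-exts hσ) (IsValueSub-exts vσ) l) (⇉-subst hσ vσ k)

-- The equation T ≡ subst σ' M' lets us match on the evaluation of a substituted term.
mutual
  ⇉-reflects-⇓-subst : ∀ {k m} {M M' : Term k} {σ σ' : Sub k m} {T W' : Term m} →
                       T ⇓ W' → T ≡ subst σ' M' → M ⇉ M' → σ ⇉ₛ σ' → IsValueSub σ →
                       ∃ λ W → subst σ M ⇓ W × W ⇉ W'
  ⇉-reflects-⇓-subst {σ = σ} D eq (pvar x) hσ vσ
    with trans (IsValue-⇓ (≡.subst IsValue (sym eq) (IsValue-⇉ (vσ x) (hσ x))) D) eq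
  ... | refl = σ x , ⇓-val (vσ x) , hσ x
  ⇉-reflects-⇓-subst (⇓-val _) refl (plam h) hσ vσ = _ , ⇓-val (lam-val _) , ⇉-subst hσ vσ (plam h)
  ⇉-reflects-⇓-subst (⇓-app D₁ D₂ D₃) refl (papp h k) hσ vσ
    with ⇉-reflects-⇓-subst D₁ refl h hσ vσ | ⇉-reflects-⇓-subst D₂ refl k hσ vσ
  ... | W₁ , E₁ , w₁ | U , E₂ , u = ⇓-app-reflects E₁ w₁ E₂ u D₃
  ⇉-reflects-⇓-subst {σ = σ} {σ'} D eq (pβ {M} {M'} {V} {V'} h k v) hσ vσ
    with ⇉-reflects-⇓-subst D (trans eq (subst-subst₁ σ' M' V')) h
           (⇉ₛ-∷ₛ (⇉-subst hσ vσ k) hσ) (IsValueSub-∷ₛ (IsValue-subst vσ v) vσ)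
  ... | W , E , w =
    W , ⇓-app (⇓-val (lam-val _)) (⇓-val (IsValue-subst vσ v)) (≡.subst (_⇓ W) (sym (subst₁-exts σ M (subst σ V))) E) , w
  ⇉-reflects-⇓-subst {σ = σ} {σ'} (⇓-app (⇓-val _) D₂ (⇓-app D₃₁ D₃₂ D₃₃)) refl
                     (pσ₁ {M} {M'} {L' = L'} h k l) hσ vσ
    with ⇉-reflects-⇓-subst D₂ refl k hσ vσ
  ... | U , E₂ , u
    with ⇉-reflects-⇓-subst D₃₁ (subst₁-exts σ' M' _) h (⇉ₛ-∷ₛ u hσ) (IsValueSub-∷ₛ (⇓-IsValue E₂) vσ)
       | ⇉-reflects-⇓-subst D₃₂ (subst₁-weaken σ' L' _) l hσ vσ
  ... | W₁ , E₃₁ , w₁ | U₂ , E₃₂ , u₂ =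
    ⇓-app-reflects (⇓-app (⇓-val (lam-val _)) E₂ (≡.subst (_⇓ W₁) (sym (subst₁-exts σ M U)) E₃₁)) w₁ E₃₂ u₂ D₃₃
  ⇉-reflects-⇓-subst {σ = σ} {σ'} (⇓-app (⇓-val _) D₂ (⇓-app D₃₁ D₃₂ D₃₃)) refl
                     (pσ₃ {V' = V'} {L} {L'} h v l k) hσ vσ
    with ⇉-reflects-⇓-subst D₂ refl k hσ vσ
  ... | U , E₂ , u
    with ⇉-reflects-⇓-subst D₃₁ (subst₁-weaken σ' V' _) h hσ vσ
       | ⇉-reflects-⇓-subst D₃₂ (subst₁-exts σ' L' _) l (⇉ₛ-∷ₛ u hσ) (IsValueSub-∷ₛ (⇓-IsValue E₂) vσ)
  ... | W₁ , E₃₁ , w₁ | U₂ , E₃₂ , u₂ =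
    ⇓-app-reflects E₃₁ w₁ (⇓-app (⇓-val (lam-val _)) E₂ (≡.subst (_⇓ U₂) (sym (subst₁-exts σ L U)) E₃₂)) u₂ D₃₃

  ⇓-app-reflects : ∀ {m} {P Q W₁ U U' : Term m} {B' W'} →
                   P ⇓ W₁ → W₁ ⇉ lam B' → Q ⇓ U → U ⇉ U' → subst₁ B' U' ⇓ W' →
                   ∃ λ W → app P Q ⇓ W × W ⇉ W'
  ⇓-app-reflects {U = U} {U'} {B'} E₁ w₁ E₂ u D with IsValue-⇉-lam (⇓-IsValue E₁) w₁
  ... | B , refl , b
    with ⇉-reflects-⇓-subst D (subst₁-∷ₛ B' U') b (⇉ₛ-∷ₛ u pvar) (IsValueSub-∷ₛ (⇓-IsValue E₂) var-val)
  ... | W , E , w = W , ⇓-app E₁ E₂ (≡.subst (_⇓ W) (sym (subst₁-∷ₛ B U)) E) , w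

⇉-reflects-⇓ : ∀ {n} {N N' W' : Term n} → N ⇉ N' → N' ⇓ W' → ∃ λ W → N ⇓ W × W ⇉ W'
⇉-reflects-⇓ {N = N} h D with ⇉-reflects-⇓-subst D (sym (subst-id _)) h pvar var-val
... | W , E , w = W , ≡.subst (_⇓ W) (subst-id N) E , w

⇉*-reflects-⇓ : ∀ {n} {N N' W' : Term n} → Star _⇉_ N N' → N' ⇓ W' → ∃ λ W → N ⇓ W × Star _⇉_ W W'
⇉*-reflects-⇓ ε D = _ , D , ε
⇉*-reflects-⇓ (h ◅ s) D with ⇉*-reflects-⇓ s D
... | W₁ , D₁ , s₁ with ⇉-reflects-⇓ h D₁
... | W , E , w = W , E , w ◅ s₁

→v*-value⇒⇓ : ∀ {n} {N V : Term n} → IsValue V → Star _→v_ N V → ∃ λ W → N ⇓ W × Star _⇉_ W V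
→v*-value⇒⇓ v s = ⇉*-reflects-⇓ (map →v⇒⇉ s) (⇓-val v)

IsValue-⇉*-var : ∀ {n} {W : Term n} {x} → IsValue W → Star _⇉_ W (var x) → W ≡ var x
IsValue-⇉*-var (var-val y) s = sym (⇉*-var s)
IsValue-⇉*-var (lam-val B) s with ⇉*-lam s
... | _ , () , _

IsValue-⇉*-lam : ∀ {n} {W : Term n} {C} → IsValue W → Star _⇉_ W (lam C) → ∃ λ B → W ≡ lam B × Star _⇉_ B C
IsValue-⇉*-lam (var-val y) s with ⇉*-var s
... | ()
IsValue-⇉*-lam (lam-val B) s with ⇉*-lam s
... | _ , refl , s' = B , refl , s'

→v*-value⇒→βv*-value : ∀ {n} {N V : Term n} → IsValue V → Star _→v_ N V →
                       ∃ λ W → IsValue W × Star _→βv_ N W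
→v*-value⇒→βv*-value v s with →v*-value⇒⇓ v s
... | W , N⇓W , _ = W , ⇓-IsValue N⇓W , ⇓⇒→βv* N⇓W

→v*-I⇒→βv*-I : ∀ {n} {N : Term n} → Star _→v_ N I → Star _→βv_ N I
→v*-I⇒→βv*-I s with →v*-value⇒⇓ (lam-val (var zero)) s
... | W , N⇓W , W⇉*I with IsValue-⇉*-lam (⇓-IsValue N⇓W) W⇉*I
... | B , refl , B⇉*x with ⇉*-reflects-⇓ B⇉*x (⇓-val (var-val zero))
... | W₂ , B⇓W₂ , W₂⇉*x with IsValue-⇉*-var (⇓-IsValue B⇓W₂) W₂⇉*x
... | refl = ⇓⇒→βv* N⇓W ◅◅ gmap lam lamC (⇓⇒→βv* B⇓W₂)

theorem5p8 : (n : ℕ) (M : Term n) → ExactScope M →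
    (PotValuable v-red M ⇔ PotValuable βv-red M) × (Solvable v-red M ⇔ Solvable βv-red M)
theorem5p8 _ _ _ =
  mk⇔ (λ (m , σ , vσ , V , v , s) → m , σ , vσ , →v*-value⇒→βv*-value v s)
      (λ (m , σ , vσ , V , v , s) → m , σ , vσ , V , v , →βv*⇒→v* s)
  , mk⇔ (λ (m , Ms , s) → m , Ms , →v*-I⇒→βv*-I s)
        (λ (m , Ms , s) → m , Ms , →βv*⇒→v* s)
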